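{- Let $\alpha,\beta,\gamma$ be ordinary lattice angles and $u,v$ integers such that $\bar\alpha+_u\bar\beta+_v\bar\gamma=\pi$. Then there exists a lattice triangle $ABC$ whose consecutive ordinary lattice angles $\angle CAB$, $\angle ABC$, $\angle BCA$ are lattice-congruent to $\alpha$, $\beta$, $\gamma$ respectively.
   Context: We work in $\mathbb R^2$ with standard orientation and lattice $\mathbb Z^2$, origin $O$. A lattice-affine transformation is $x\mapsto Mx+b$, $M\in GL_2(\mathbb Z)$, $b\in\mathbb Z^2$; proper if $\det M=1$. $\operatorname{l\ell}(AB)$ is the number of lattice points on segment $AB$ minus one. An ordinary lattice angle $\angle XYZ$ is the ordered pair (ray $YX$, ray $YZ$) with $X,Y,Z$ lattice points not collinear; two are lattice-congruent if a lattice-affine map sends vertex to vertex and first/second ray onto first/second ray. Lattice sine/tangent: let $v_1,v_2$ be primitive lattice vectors along $YX$, $YZ$; lattice points $P$ with $(v_1,P-Y)$ a basis form two lines parallel to $YX$; ray $YZ$ meets exactly one, $l$, at $Q$; $D$ is the lattice point of $l$ nearest $Q$ among those strictly on the other side of line $YZ$ from $X$; writing $v_2=x_1v_1+x_2(D-Y)$, $\operatorname{lsin}\angle XYZ=x_2$, $\operatorname{ltan}\angle XYZ=x_2/x_1\ge1$. If $X,Y,Z$ are collinear put $\operatorname{lsin}\angle XYZ=0$. Broken lines: $\operatorname{sgn}(A,B,C)$ is the sign of $\det(A-B,C-B)$. A lattice oriented broken line $A_0\dots A_N$ ($N\ge1$) is a sequence of lattice points with $A_{i-1}\ne A_i$ (consecutive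 segments may be collinear); on unit distance from lattice point $V$ if each primitive vector along $A_{i-1}A_i$ with $V-A_{i-1}$ is a basis of $\mathbb Z^2$. Signed length-sine sequence: $a_{2i-2}=\operatorname{sgn}(A_{i-1},V,A_i)\operatorname{l\ell}(A_{i-1}A_i)$, $a_{2i-1}=\operatorname{sgn}(A_{i-1},V,A_i)\operatorname{sgn}(A_i,V,A_{i+1})\operatorname{sgn}(A_{i-1},A_i,A_{i+1})\operatorname{lsin}\angle A_{i-1}A_iA_{i+1}$. Broken lines on unit distance from $V$ are equivalent if they share first and last vertices and the first followed by the reverse of the second is null-homotopic in $\mathbb R^2\setminus\{V\}$. $(V,l)$ is proper lattice-congruent to $(V',l')$ if a proper lattice-affine map sends $V$ to $V'$ and $l$ to a broken line equivalent to $l'$. Sums: for $k\ge1$, $S_k$ is $k-1$ copies of $(1,-2,1,-2)$ followed by $(1,-2,1)$ (so $S_1=(1,-2,1)$), and $L_k$ is the broken line on unit distance from $O$ with first vertices $(1,0),(1,1)$ and signed length-sine sequence $S_k$. The sequence of an ordinary lattice angle $\alpha$ is $(c_0,\dots,c_{2r})$ where $\operatorname{ltan}\alpha=[c_0;c_1,\dots,c_{2r}]$ is its odd continued fraction. For ordinary lattice angles $\beta_1,\dots,\beta_l$ and integers $m_1,\dots,m_{l-1}$, $\bar\beta_1+_{m_1}\cdots+_{m_{l-1}}\bar\beta_l=k\pi$ means: some broken line $l$ on unit distance from a lattice point $V$ with signed length-sine sequence (sequence of $\beta_1$, $m_1$, $\dots$, $m_{l-1}$, sequence of $\beta_l$)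 has $(V,l)$ proper lattice-congruent to $(O,L_k)$; $\pi$ means $1\pi$. -}

module Defs where

open import Data.Nat as ℕ using (ℕ; zero; suc)
open import Data.Integer as ℤ using (ℤ; +_; -[1+_]; +[1+_]; _+_; _-_; _*_; -_; _≤_; _<_; _≤?_; _<?_; 0ℤ; 1ℤ)
open import Data.Integer.GCD using (gcd)
open import Data.Product using (Σ; ∃; ∃-syntax; _×_; _,_; proj₁; proj₂)
open import Data.Sum using (_⊎_)
open import Data.List using (List; []; _∷_; _++_; length; map; reverse; concat; replicate; head; last; drop)
open import Data.Bool using (if_then_else_; _∧_)
open import Relation.Nullary using (¬_)
open import Data.Unit using (⊤)
open import Data.Empty using (⊥)
open import Relation.Nullary.Decidable using (⌊_⌋)
open import Relation.Binary.PropositionalEquality using (_≡_; _≢_)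

Pt : Set
Pt = ℤ × ℤ

O : Pt
O = (0ℤ , 0ℤ)

_⊕_ : Pt → Pt → Pt
(a , b) ⊕ (c , d) = (a + c , b + d)

_⊖_ : Pt → Pt → Pt
(a , b) ⊖ (c , d) = (a - c , b - d)

infixl 7 _•_
_•_ : ℤ → Pt → Pt
k • (a , b) = (k * a , k * b)

det : Pt → Pt → ℤ
det (a , b) (c , d) = a * d - b * c

norm² : Pt → ℤ
norm² (a , b) = a * a + b * b

sgnℤ : ℤ → ℤ
sgnℤ (+ zero)  = 0ℤ
sgnℤ +[1+ _ ]  = 1ℤ
sgnℤ -[1+ _ ]  = - 1ℤ

sgn : Pt → Pt → Pt → ℤ
sgn A B C = sgnℤ (det (A ⊖ B) (C ⊖ B))

Collinear : Pt → Pt → Pt → Set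
Collinear X Y Z = det (X ⊖ Y) (Z ⊖ Y) ≡ 0ℤ

Primitive : Pt → Set
Primitive (a , b) = gcd a b ≡ 1ℤ

-- SegData A B u k : u is the primitive lattice vector along AB (from A
-- towards B) and B - A = k u with k ≥ 1; the lattice points of the segment
-- AB are then exactly A + j u (0 ≤ j ≤ k), so k = lℓ(AB).
SegData : Pt → Pt → Pt → ℕ → Set
SegData A B u k = Primitive u × (1 ℕ.≤ k) × (B ⊖ A ≡ (+ k) • u)

-- Lattice-affine transformations  x ↦ M x + b,  M ∈ GL₂(ℤ)

record LAff : Set where
  constructor laff
  field
    m11 m12 m21 m22 : ℤ
    b1 b2 : ℤ

detM : LAff → ℤ
detM f = LAff.m11 f * LAff.m22 f - LAff.m12 f * LAff.m21 f

IsLatticeAffine : LAff → Set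
IsLatticeAffine f = (detM f ≡ 1ℤ) ⊎ (detM f ≡ - 1ℤ)

IsProper : LAff → Set
IsProper f = detM f ≡ 1ℤ

apply : LAff → Pt → Pt
apply (laff a b c d e g) (x , y) = (a * x + b * y + e , c * x + d * y + g)

record Angle : Set where
  constructor ∠
  field
    X Y Z : Pt
    nonCollinear : ¬ Collinear X Y Z

SameRay : Pt → Pt → Pt → Pt → Set
SameRay Y P Y' P' = ∃[ m ] ∃[ n ] (1 ℕ.≤ m) × (1 ℕ.≤ n) × ((+ m) • (P ⊖ Y) ≡ (+ n) • (P' ⊖ Y'))

LatticeCongruent : Angle → Angle → Set
LatticeCongruent (∠ X Y Z _) (∠ X' Y' Z' _) =
  Σ LAff λ f → IsLatticeAffine f × (apply f Y ≡ Y')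
    × SameRay Y' (apply f X) Y' X' × SameRay Y' (apply f Z) Y' Z'

-- LSinTan X Y Z x₁ x₂ : for the non-collinear X,Y,Z, with v₁,v₂ the
-- primitive vectors along YX, YZ, the line l is {P | det(v₁,P-Y) = ε}
-- with ε = sign det(v₁,v₂) (the one of the two lines met by ray YZ, at
-- Q = Y + (ε/δ) v₂, δ = det(v₁,v₂)); D ∈ l is strictly on the other side
-- of line YZ from X and is nearest to Q among such lattice points of l
-- (|Q - P| = |ε v₂ - δ (P - Y)| / |δ|); and v₂ = x₁ v₁ + x₂ (D - Y).
-- Then lsin ∠XYZ = x₂ and ltan ∠XYZ = x₂ / x₁.

LSinTan : Pt → Pt → Pt → ℤ → ℤ → Set
LSinTan X Y Z x₁ x₂ =
  ¬ Collinear X Y Z ×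
  Σ Pt λ v₁ → Σ Pt λ v₂ → Σ Pt λ D → Σ ℕ λ k₁ → Σ ℕ λ k₂ →
    let δ = det v₁ v₂
        ε = sgnℤ δ
        OnL : Pt → Set
        OnL P = det v₁ (P ⊖ Y) ≡ ε
        OtherSide : Pt → Set
        OtherSide P = sgnℤ (det v₂ (P ⊖ Y)) ≡ - sgnℤ (det v₂ (X ⊖ Y))
        distQ : Pt → ℤ
        distQ P = norm² ((ε • v₂) ⊖ (δ • (P ⊖ Y)))
    in SegData Y X v₁ k₁ × SegData Y Z v₂ k₂
       × OnL D × OtherSide D
       × (∀ P → OnL P → OtherSide P → distQ D ≤ distQ P)
       × (v₂ ≡ (x₁ • v₁) ⊕ (x₂ • (D ⊖ Y)))

LSin : Pt → Pt → Pt → ℤ → Set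
LSin X Y Z s = (Collinear X Y Z × s ≡ 0ℤ) ⊎ (∃[ x₁ ] LSinTan X Y Z x₁ s)

-- Continued fractions:  [c₀; c₁, …, cₙ] = cfNum / cfDen

cf : ℤ → List ℤ → ℤ × ℤ
cf c []       = (c , 1ℤ)
cf c (d ∷ ds) = let (p , q) = cf d ds in (c * p + q , p)

AllPos : List ℤ → Set
AllPos []       = ⊤
AllPos (c ∷ cs) = (1ℤ ≤ c) × AllPos cs

-- the sequence of an ordinary lattice angle: (c₀,…,c_{2r}) with
-- ltan α = [c₀; c₁, …, c_{2r}] (odd continued fraction, cᵢ ≥ 1 for i ≥ 1)
AngleSeq : Angle → List ℤ → Set
AngleSeq (∠ X Y Z _) [] = ⊥
AngleSeq (∠ X Y Z _) (c₀ ∷ cs) =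
  (∃[ r ] length cs ≡ 2 ℕ.* r) × AllPos cs ×
  (∃[ x₁ ] ∃[ x₂ ] LSinTan X Y Z x₁ x₂ ×
     (proj₁ (cf c₀ cs) * x₁ ≡ proj₂ (cf c₀ cs) * x₂))

IsBrokenLine : List Pt → Set
IsBrokenLine []            = ⊥
IsBrokenLine (_ ∷ [])      = ⊥
IsBrokenLine (A ∷ B ∷ [])  = A ≢ B
IsBrokenLine (A ∷ B ∷ C ∷ l) = A ≢ B × IsBrokenLine (B ∷ C ∷ l)

UnitSeg : Pt → Pt → Pt → Set
UnitSeg V A B = ∃[ u ] ∃[ k ] SegData A B u k × ((det u (V ⊖ A) ≡ 1ℤ) ⊎ (det u (V ⊖ A) ≡ - 1ℤ))

UnitDist : Pt → List Pt → Set
UnitDist V []            = ⊤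
UnitDist V (_ ∷ [])      = ⊤
UnitDist V (A ∷ B ∷ l)   = UnitSeg V A B × UnitDist V (B ∷ l)

data SLS (V : Pt) : List Pt → List ℤ → Set where
  last-seg : ∀ {A B u k} → SegData A B u k →
    SLS V (A ∷ B ∷ []) (sgn A V B * + k ∷ [])
  more : ∀ {A B C l s u k σ} → SegData A B u k → LSin A B C σ →
    SLS V (B ∷ C ∷ l) s →
    SLS V (A ∷ B ∷ C ∷ l) (sgn A V B * + k ∷ sgn A V B * sgn B V C * sgn A B C * σ ∷ s)

-- Winding number of a closed polygon (list of vertices with first = last)
-- around V (standard signed crossing count of the ray from V in
-- direction (1,0)); for closed polygonal loops avoiding V, this is the
-- class of the loop in π₁(ℝ² ∖ {V}) ≅ ℤ, so the loop is null-homotopic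
-- in ℝ² ∖ {V} iff its winding number is 0.

crossing : Pt → Pt → ℤ
crossing p q =
  if ⌊ proj₂ p ≤? 0ℤ ⌋ ∧ ⌊ 0ℤ <? proj₂ q ⌋ ∧ ⌊ 0ℤ <? det p q ⌋ then 1ℤ
  else (if ⌊ proj₂ q ≤? 0ℤ ⌋ ∧ ⌊ 0ℤ <? proj₂ p ⌋ ∧ ⌊ det p q <? 0ℤ ⌋ then - 1ℤ
  else 0ℤ)

wind : Pt → List Pt → ℤ
wind V []            = 0ℤ
wind V (_ ∷ [])      = 0ℤ
wind V (A ∷ B ∷ l)   = crossing (A ⊖ V) (B ⊖ V) + wind V (B ∷ l)

EquivBL : Pt → List Pt → List Pt → Set
EquivBL V l l' = (head l ≡ head l') × (last l ≡ last l')
  × (wind V (l ++ drop 1 (reverse l')) ≡ 0ℤ)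

ProperCong : Pt → List Pt → Pt → List Pt → Set
ProperCong V l V' l' = Σ LAff λ f → IsProper f × (apply f V ≡ V')
  × EquivBL V' (map (apply f) l) l'

Sseq : ℕ → List ℤ
Sseq k = concat (replicate (k ℕ.∸ 1) (1ℤ ∷ - + 2 ∷ 1ℤ ∷ - + 2 ∷ [])) ++ (1ℤ ∷ - + 2 ∷ 1ℤ ∷ [])

IsL : ℕ → List Pt → Set
IsL k L = IsBrokenLine L × UnitDist O L
  × (∃[ rest ] L ≡ (1ℤ , 0ℤ) ∷ (1ℤ , 1ℤ) ∷ rest) × SLS O L (Sseq k)

data CombSeq : List Angle → List ℤ → List ℤ → Set where
  single : ∀ {β s} → AngleSeq β s → CombSeq (β ∷ []) [] s
  cons   : ∀ {β βs m ms s t} → AngleSeq β s → CombSeq βs ms t →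
    CombSeq (β ∷ βs) (m ∷ ms) (s ++ m ∷ t)

SumEq : List Angle → List ℤ → ℕ → Set
SumEq βs ms k = Σ Pt λ V → Σ (List Pt) λ l → Σ (List ℤ) λ s →
  CombSeq βs ms s × IsBrokenLine l × UnitDist V l × SLS V l s
  × (Σ (List Pt) λ L → IsL k L × ProperCong V l O L)

-- Walk along a broken line on unit distance from V, keeping the position P of the current
-- vertex relative to V and the primitive vector w of the current edge, oriented so that
-- det(P, w) = 1: a length entry a of the signed length-sine sequence replaces P by P + a w,
-- a sine entry b replaces w by w + b P.  Along the sequence of an angle with
-- ltan = [c₀; c₁, …, c₂ᵣ] = p/q this sends P to q P + p w, and congruence with L₁ says that
-- the whole walk ends at -P.  If P_α and P_β are the positions reached after the sequences
-- of α and of β, then det(P, P_α) = p_α, det(P_α, P_β) = p_β and det(P, P_β) = p_γ, so the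
-- Plücker relation p_β P + p_α P_β = p_γ P_α closes the triangle 0, p_γ P_α, p_β P.  At each
-- vertex the two sides point along a P' and b (q P' + p w') for the local frame (P', w'), and
-- the unimodular map sending that frame to the basis (v₁, D - Y) of the lattice-sine
-- construction of the given angle is the required congruence.

{-# OPTIONS --safe #-}
module Submission where

open import Defs
open import Data.Empty using (⊥-elim)
open import Data.Integer as ℤ using (ℤ; +_; +[1+_]; -[1+_]; _+_; _-_; _*_; -_; 0ℤ; 1ℤ; ∣_∣; +≤+)
open import Data.Integer.GCD using (gcd)
import Data.Integer.Properties as ℤP
open import Data.Integer.Tactic.RingSolver using (solve-∀)
open import Data.List using (List; []; _∷_; _++_; length; map; last)
open import Data.List.Properties using (last-map)
import Data.Maybe as Maybe
open import Data.Maybe using (just)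
open import Data.Maybe.Properties using (just-injective)
open import Data.Nat as ℕ using (ℕ; zero; suc; s≤s; z≤n)
open import Data.Nat.GCD using (c*gcd[m,n]≡gcd[cm,cn]) renaming (gcd to gcdℕ)
import Data.Nat.Properties as ℕP
open import Data.Product using (Σ; ∃₂; ∃-syntax; _×_; _,_; proj₁; proj₂; uncurry)
open import Data.Sum using (_⊎_; inj₁; inj₂)
open import Function using (_∘_)
open import Relation.Nullary using (¬_)
open import Relation.Binary.PropositionalEquality
open ≡-Reasoning

Unit : ℤ → Set
Unit s = s ≡ 1ℤ ⊎ s ≡ - 1ℤ

Pos : ℤ → Set
Pos x = ∃[ n ] x ≡ +[1+ n ]

unit-square : ∀ {s} → Unit s → s * s ≡ 1ℤ
unit-square (inj₁ refl) = refl
unit-square (inj₂ refl) = refl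

sgnℤ-unit : ∀ {s} → Unit s → sgnℤ s ≡ s
sgnℤ-unit (inj₁ refl) = refl
sgnℤ-unit (inj₂ refl) = refl

sgnℤ-pos* : ∀ k x → sgnℤ (+[1+ k ] * x) ≡ sgnℤ x
sgnℤ-pos* k (+ zero)  = cong sgnℤ (ℤP.*-zeroʳ +[1+ k ])
sgnℤ-pos* k +[1+ n ] = refl
sgnℤ-pos* k -[1+ n ] = refl

sgnℤ-factor : ∀ {δ x} → δ ≢ 0ℤ → δ ≡ x * sgnℤ δ → Unit (sgnℤ δ) × Pos x
sgnℤ-factor {+ zero}   δ≢0 _   = ⊥-elim (δ≢0 refl)
sgnℤ-factor {+[1+ n ]} {x} _ δ≡x = inj₁ refl , n , sym (trans δ≡x (ℤP.*-identityʳ x))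
sgnℤ-factor { -[1+ n ]} {x} _ δ≡x = inj₂ refl , n , trans (eq x) (cong -_ (sym δ≡x))
  where
  eq : ∀ x → x ≡ - (x * - 1ℤ)
  eq = solve-∀

pos≢0 : ∀ {x} → Pos x → x ≢ 0ℤ
pos≢0 (_ , refl) ()

pos-* : ∀ {x y} → Pos x → Pos y → Pos (x * y)
pos-* (_ , refl) (_ , refl) = _ , refl

pos*≡0 : ∀ k {x} → +[1+ k ] * x ≡ 0ℤ → x ≡ 0ℤ
pos*≡0 k e with ℤP.i*j≡0⇒i≡0∨j≡0 +[1+ k ] e
... | inj₁ ()
... | inj₂ x≡0 = x≡0

pos-of-proportion : ∀ {p x q y} → Pos x → Pos q → Pos y → p * x ≡ q * y → Pos p
pos-of-proportion {+[1+ n ]} _ _ _ _ = n , refl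
pos-of-proportion {+ zero}   (_ , refl) (_ , refl) (_ , refl) ()
pos-of-proportion { -[1+ _ ]} (_ , refl) (_ , refl) (_ , refl) ()

neg : Pt → Pt
neg (a , b) = (- a , - b)

⊕-comm : ∀ X Y → X ⊕ Y ≡ Y ⊕ X
⊕-comm (x₁ , x₂) (y₁ , y₂) = cong₂ _,_ (ℤP.+-comm x₁ y₁) (ℤP.+-comm x₂ y₂)

•-identityˡ : ∀ X → 1ℤ • X ≡ X
•-identityˡ (x₁ , x₂) = cong₂ _,_ (ℤP.*-identityˡ x₁) (ℤP.*-identityˡ x₂)

•-cancel : ∀ k X Y → +[1+ k ] • X ≡ +[1+ k ] • Y → X ≡ Y
•-cancel k (x₁ , x₂) (y₁ , y₂) e =
  cong₂ _,_ (ℤP.*-cancelˡ-≡ +[1+ k ] x₁ y₁ (cong proj₁ e))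
            (ℤP.*-cancelˡ-≡ +[1+ k ] x₂ y₂ (cong proj₂ e))

neg-• : ∀ k X → neg (k • X) ≡ k • neg X
neg-• k (x₁ , x₂) = cong₂ _,_ (ℤP.neg-distribʳ-* k x₁) (ℤP.neg-distribʳ-* k x₂)

⊖-identityʳ : ∀ X → X ⊖ O ≡ X
⊖-identityʳ (x₁ , x₂) = cong₂ _,_ (ℤP.+-identityʳ x₁) (ℤP.+-identityʳ x₂)

O⊖≡neg : ∀ X → O ⊖ X ≡ neg X
O⊖≡neg (x₁ , x₂) = cong₂ _,_ (ℤP.+-identityˡ (- x₁)) (ℤP.+-identityˡ (- x₂))

⊕-⊖-cancelˡ : ∀ X Y → (X ⊕ Y) ⊖ X ≡ Y
⊕-⊖-cancelˡ (x₁ , x₂) (y₁ , y₂) = cong₂ _,_ (eq x₁ y₁) (eq x₂ y₂)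
  where
  eq : ∀ x y → x + y - x ≡ y
  eq = solve-∀

⊖-⊕-cancelˡ : ∀ X Y → X ⊖ (X ⊕ Y) ≡ neg Y
⊖-⊕-cancelˡ (x₁ , x₂) (y₁ , y₂) = cong₂ _,_ (eq x₁ y₁) (eq x₂ y₂)
  where
  eq : ∀ x y → x - (x + y) ≡ - y
  eq = solve-∀

⊕-⊖-inverse : ∀ X Y → X ⊕ (Y ⊖ X) ≡ Y
⊕-⊖-inverse (x₁ , x₂) (y₁ , y₂) = cong₂ _,_ (eq x₁ y₁) (eq x₂ y₂)
  where
  eq : ∀ x y → x + (y - x) ≡ y
  eq = solve-∀

⊖-via : ∀ A B V → B ⊖ V ≡ (A ⊖ V) ⊕ (B ⊖ A)
⊖-via (a₁ , a₂) (b₁ , b₂) (v₁ , v₂) = cong₂ _,_ (eq a₁ b₁ v₁) (eq a₂ b₂ v₂)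
  where
  eq : ∀ a b v → b - v ≡ a - v + (b - a)
  eq = solve-∀

⊖-anti : ∀ X Y → X ⊖ Y ≡ neg (Y ⊖ X)
⊖-anti (x₁ , x₂) (y₁ , y₂) = cong₂ _,_ (eq x₁ y₁) (eq x₂ y₂)
  where
  eq : ∀ x y → x - y ≡ - (y - x)
  eq = solve-∀

neg-lincomb : ∀ a b X Y → neg ((a • X) ⊕ (b • Y)) ≡ (a • neg X) ⊕ (b • neg Y)
neg-lincomb a b (x₁ , x₂) (y₁ , y₂) = cong₂ _,_ (eq a b x₁ y₁) (eq a b x₂ y₂)
  where
  eq : ∀ a b x y → - (a * x + b * y) ≡ a * - x + b * - y
  eq = solve-∀

•-lincomb : ∀ c a b X Y → c • ((a • X) ⊕ (b • Y)) ≡ ((c * a) • X) ⊕ ((c * b) • Y)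
•-lincomb c a b (x₁ , x₂) (y₁ , y₂) = cong₂ _,_ (eq c a b x₁ y₁) (eq c a b x₂ y₂)
  where
  eq : ∀ c a b x y → c * (a * x + b * y) ≡ c * a * x + c * b * y
  eq = solve-∀

•-as-lincomb : ∀ a X Y → a • X ≡ (a • X) ⊕ (0ℤ • Y)
•-as-lincomb a (x₁ , x₂) (y₁ , y₂) = cong₂ _,_ (eq a x₁ y₁) (eq a x₂ y₂)
  where
  eq : ∀ a x y → a * x ≡ a * x + 0ℤ * y
  eq = solve-∀

•-ray : ∀ k a X Y → k • ((a • X) ⊕ (0ℤ • Y)) ≡ a • (k • X)
•-ray k a (x₁ , x₂) (y₁ , y₂) = cong₂ _,_ (eq k a x₁ y₁) (eq k a x₂ y₂)
  where
  eq : ∀ k a x y → k * (a * x + 0ℤ * y) ≡ a * (k * x)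
  eq = solve-∀

unit-•-cancel : ∀ {ε} → Unit ε → ∀ c X → (ε * c) • (ε • X) ≡ c • X
unit-•-cancel {ε} ε-unit c (x₁ , x₂) = cong₂ _,_ (cancel x₁) (cancel x₂)
  where
  eq : ∀ e c x → e * c * (e * x) ≡ e * e * (c * x)
  eq = solve-∀
  cancel : ∀ x → ε * c * (ε * x) ≡ c * x
  cancel x = trans (eq ε c x) (trans (cong (_* (c * x)) (unit-square ε-unit)) (ℤP.*-identityˡ (c * x)))

proportional-rays : ∀ {p x₁ q x₂} → p * x₁ ≡ q * x₂ → ∀ k b X Y →
  (k * x₂) • (((b * q) • X) ⊕ ((b * p) • Y)) ≡ (b * p) • (k • ((x₁ • X) ⊕ (x₂ • Y)))
proportional-rays {p} {x₁} {q} {x₂} prop k b (X₁ , X₂) (Y₁ , Y₂) =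
  cong₂ _,_ (component X₁ Y₁) (component X₂ Y₂)
  where
  expand : ∀ k b p q x₁ x₂ x y →
    k * x₂ * (b * q * x + b * p * y) ≡ k * b * x * (q * x₂) + k * x₂ * b * p * y
  expand = solve-∀
  collect : ∀ k b p q x₁ x₂ x y →
    k * b * x * (p * x₁) + k * x₂ * b * p * y ≡ b * p * (k * (x₁ * x + x₂ * y))
  collect = solve-∀
  component : ∀ x y → k * x₂ * (b * q * x + b * p * y) ≡ b * p * (k * (x₁ * x + x₂ * y))
  component x y = begin
    k * x₂ * (b * q * x + b * p * y)             ≡⟨ expand k b p q x₁ x₂ x y ⟩
    k * b * x * (q * x₂) + k * x₂ * b * p * y    ≡⟨ cong (λ t → k * b * x * t + k * x₂ * b * p * y) (sym prop) ⟩
    k * b * x * (p * x₁) + k * x₂ * b * p * y    ≡⟨ collect k b p q x₁ x₂ x y ⟩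
    b * p * (k * (x₁ * x + x₂ * y))              ∎

cf-step : ∀ P w c c₁ p q →
  (q • (P ⊕ (c • w))) ⊕ (p • (w ⊕ (c₁ • (P ⊕ (c • w)))))
    ≡ ((c₁ * p + q) • P) ⊕ ((c * (c₁ * p + q) + p) • w)
cf-step (P₁ , P₂) (w₁ , w₂) c c₁ p q = cong₂ _,_ (eq P₁ w₁ c c₁ p q) (eq P₂ w₂ c c₁ p q)
  where
  eq : ∀ P w c c₁ p q →
    q * (P + c * w) + p * (w + c₁ * (P + c * w)) ≡ (c₁ * p + q) * P + (c * (c₁ * p + q) + p) * w
  eq = solve-∀

det-anti : ∀ u v → det u v ≡ - det v u
det-anti (a , b) (c , d) = eq a b c d
  where
  eq : ∀ a b c d → a * d - b * c ≡ - (c * b - d * a)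
  eq = solve-∀

det-negˡ : ∀ u v → det (neg u) v ≡ det v u
det-negˡ (a , b) (c , d) = eq a b c d
  where
  eq : ∀ a b c d → - a * d - - b * c ≡ c * b - d * a
  eq = solve-∀

det-negʳ : ∀ u v → det u (neg v) ≡ det v u
det-negʳ (a , b) (c , d) = eq a b c d
  where
  eq : ∀ a b c d → a * - d - b * - c ≡ c * b - d * a
  eq = solve-∀

det-neg : ∀ u v → det (neg u) (neg v) ≡ det u v
det-neg (a , b) (c , d) = eq a b c d
  where
  eq : ∀ a b c d → - a * - d - - b * - c ≡ a * d - b * c
  eq = solve-∀

det-swap-⊖ : ∀ u A V → det u (V ⊖ A) ≡ det (A ⊖ V) u
det-swap-⊖ (u₁ , u₂) (a₁ , a₂) (v₁ , v₂) = eq u₁ u₂ a₁ a₂ v₁ v₂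
  where
  eq : ∀ u₁ u₂ a₁ a₂ v₁ v₂ → u₁ * (v₂ - a₂) - u₂ * (v₁ - a₁) ≡ (a₁ - v₁) * u₂ - (a₂ - v₂) * u₁
  eq = solve-∀

det-•ʳ : ∀ P c u → det P (c • u) ≡ c * det P u
det-•ʳ (p₁ , p₂) c (u₁ , u₂) = eq p₁ p₂ c u₁ u₂
  where
  eq : ∀ p₁ p₂ c u₁ u₂ → p₁ * (c * u₂) - p₂ * (c * u₁) ≡ c * (p₁ * u₂ - p₂ * u₁)
  eq = solve-∀

det-•• : ∀ s t u v → det (s • u) (t • v) ≡ s * (t * det u v)
det-•• s t (a , b) (c , d) = eq s t a b c d
  where
  eq : ∀ s t a b c d → s * a * (t * d) - s * b * (t * c) ≡ s * (t * (a * d - b * c))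
  eq = solve-∀

det-⊕•ʳ : ∀ P c u → det P (P ⊕ (c • u)) ≡ c * det P u
det-⊕•ʳ (p₁ , p₂) c (u₁ , u₂) = eq p₁ p₂ c u₁ u₂
  where
  eq : ∀ p₁ p₂ c u₁ u₂ → p₁ * (p₂ + c * u₂) - p₂ * (p₁ + c * u₁) ≡ c * (p₁ * u₂ - p₂ * u₁)
  eq = solve-∀

det-⊕•ˡ : ∀ P c w → det (P ⊕ (c • w)) w ≡ det P w
det-⊕•ˡ (p₁ , p₂) c (w₁ , w₂) = eq p₁ p₂ c w₁ w₂
  where
  eq : ∀ p₁ p₂ c w₁ w₂ → (p₁ + c * w₁) * w₂ - (p₂ + c * w₂) * w₁ ≡ p₁ * w₂ - p₂ * w₁
  eq = solve-∀

det-shear : ∀ P c w → det P (w ⊕ (c • P)) ≡ det P w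
det-shear (p₁ , p₂) c (w₁ , w₂) = eq p₁ p₂ c w₁ w₂
  where
  eq : ∀ p₁ p₂ c w₁ w₂ → p₁ * (w₂ + c * p₂) - p₂ * (w₁ + c * p₁) ≡ p₁ * w₂ - p₂ * w₁
  eq = solve-∀

det-lincombˡ : ∀ P x y w → det ((x • P) ⊕ (y • w)) w ≡ x * det P w
det-lincombˡ (p₁ , p₂) x y (w₁ , w₂) = eq p₁ p₂ x y w₁ w₂
  where
  eq : ∀ p₁ p₂ x y w₁ w₂ → (x * p₁ + y * w₁) * w₂ - (x * p₂ + y * w₂) * w₁ ≡ x * (p₁ * w₂ - p₂ * w₁)
  eq = solve-∀

det-lincombʳ : ∀ P x y w → det P ((x • P) ⊕ (y • w)) ≡ y * det P w
det-lincombʳ (p₁ , p₂) x y (w₁ , w₂) = eq p₁ p₂ x y w₁ w₂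
  where
  eq : ∀ p₁ p₂ x y w₁ w₂ → p₁ * (x * p₂ + y * w₂) - p₂ * (x * p₁ + y * w₁) ≡ y * (p₁ * w₂ - p₂ * w₁)
  eq = solve-∀

cramer : ∀ P w w' → det P w • w' ≡ (det w' w • P) ⊕ (det P w' • w)
cramer (p₁ , p₂) (w₁ , w₂) (v₁ , v₂) = cong₂ _,_ (eq₁ p₁ p₂ w₁ w₂ v₁ v₂) (eq₂ p₁ p₂ w₁ w₂ v₁ v₂)
  where
  eq₁ : ∀ p₁ p₂ w₁ w₂ v₁ v₂ →
    (p₁ * w₂ - p₂ * w₁) * v₁ ≡ (v₁ * w₂ - v₂ * w₁) * p₁ + (p₁ * v₂ - p₂ * v₁) * w₁
  eq₁ = solve-∀
  eq₂ : ∀ p₁ p₂ w₁ w₂ v₁ v₂ →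
    (p₁ * w₂ - p₂ * w₁) * v₂ ≡ (v₁ * w₂ - v₂ * w₁) * p₂ + (p₁ * v₂ - p₂ * v₁) * w₂
  eq₂ = solve-∀

plücker : ∀ P Q R → (det Q R • P) ⊕ (det P Q • R) ≡ det P R • Q
plücker (a , b) (c , d) (e , f) = cong₂ _,_ (eq₁ a b c d e f) (eq₂ a b c d e f)
  where
  eq₁ : ∀ a b c d e f → (c * f - d * e) * a + (a * d - b * c) * e ≡ (a * f - b * e) * c
  eq₁ = solve-∀
  eq₂ : ∀ a b c d e f → (c * f - d * e) * b + (a * d - b * c) * f ≡ (a * f - b * e) * d
  eq₂ = solve-∀

det-coord₁ : ∀ P w x y {Q} → det P w ≡ 1ℤ → Q ≡ (x • P) ⊕ (y • w) → det Q w ≡ x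
det-coord₁ P w x y dPw refl =
  trans (det-lincombˡ P x y w) (trans (cong (x *_) dPw) (ℤP.*-identityʳ x))

det-coord₂ : ∀ P w x y {Q} → det P w ≡ 1ℤ → Q ≡ (x • P) ⊕ (y • w) → det P Q ≡ y
det-coord₂ P w x y dPw refl =
  trans (det-lincombʳ P x y w) (trans (cong (y *_) dPw) (ℤP.*-identityʳ y))

basis-change : ∀ {P w w'} → det P w ≡ 1ℤ → det P w' ≡ 1ℤ → w' ≡ w ⊕ (det w' w • P)
basis-change {P} {w} {w'} dPw dPw' = begin
  w'                                 ≡⟨ sym (•-identityˡ w') ⟩
  1ℤ • w'                            ≡⟨ cong (_• w') (sym dPw) ⟩
  det P w • w'                       ≡⟨ cramer P w w' ⟩
  (det w' w • P) ⊕ (det P w' • w)    ≡⟨ cong (λ c → (det w' w • P) ⊕ (c • w)) dPw' ⟩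
  (det w' w • P) ⊕ (1ℤ • w)          ≡⟨ cong ((det w' w • P) ⊕_) (•-identityˡ w) ⟩
  (det w' w • P) ⊕ w                 ≡⟨ ⊕-comm _ w ⟩
  w ⊕ (det w' w • P)                 ∎

primitive-•-gcd : ∀ k a b → Primitive (a , b) → gcd (+ k * a) (+ k * b) ≡ + k
primitive-•-gcd k a b prim = cong +_ (begin
  gcdℕ (∣ + k * a ∣) (∣ + k * b ∣)   ≡⟨ cong₂ gcdℕ (ℤP.abs-* (+ k) a) (ℤP.abs-* (+ k) b) ⟩
  gcdℕ (k ℕ.* ∣ a ∣) (k ℕ.* ∣ b ∣)   ≡⟨ sym (c*gcd[m,n]≡gcd[cm,cn] k ∣ a ∣ ∣ b ∣) ⟩
  k ℕ.* gcdℕ (∣ a ∣) (∣ b ∣)         ≡⟨ cong (k ℕ.*_) (ℤP.+-injective prim) ⟩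
  k ℕ.* 1                            ≡⟨ ℕP.*-identityʳ k ⟩
  k                                  ∎)

segData-unique : ∀ {A B u k u' k'} → SegData A B u k → SegData A B u' k' → k ≡ k' × u ≡ u'
segData-unique {u = u₁ , u₂} {k = suc k} {u' = u₁' , u₂'} {k'}
  (prim , s≤s _ , B-A) (prim' , _ , B-A') =
  k≡k' , •-cancel k _ _ (trans scaled (cong (λ j → + j • (u₁' , u₂')) (sym k≡k')))
  where
  scaled : +[1+ k ] • (u₁ , u₂) ≡ + k' • (u₁' , u₂')
  scaled = trans (sym B-A) B-A'
  k≡k' : suc k ≡ k'
  k≡k' = ℤP.+-injective (begin
    +[1+ k ]                             ≡⟨ sym (primitive-•-gcd (suc k) u₁ u₂ prim) ⟩
    uncurry gcd (+[1+ k ] • (u₁ , u₂))   ≡⟨ cong (uncurry gcd) scaled ⟩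
    uncurry gcd (+ k' • (u₁' , u₂'))     ≡⟨ primitive-•-gcd k' u₁' u₂' prim' ⟩
    + k'                                 ∎)

segData-⊖ : ∀ V {A B u k} → SegData A B u k → B ⊖ V ≡ (A ⊖ V) ⊕ (+ k • u)
segData-⊖ V {A} {B} (_ , _ , B-A) = trans (⊖-via A B V) (cong ((A ⊖ V) ⊕_) B-A)

segData-reverse : ∀ {A B u k} → SegData A B u k → SegData B A (neg u) k
segData-reverse {A} {B} {u₁ , u₂} {k} (prim , 1≤k , B-A) =
  prim' , 1≤k , trans (⊖-anti A B) (trans (cong neg B-A) (neg-• (+ k) (u₁ , u₂)))
  where
  prim' : gcd (- u₁) (- u₂) ≡ 1ℤ
  prim' = trans (cong₂ (λ m n → + gcdℕ m n) (ℤP.∣-i∣≡∣i∣ u₁) (ℤP.∣-i∣≡∣i∣ u₂)) prim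

segData-det : ∀ {A B C u k u' k'} → SegData A B u k → SegData B C u' k' →
  det (A ⊖ B) (C ⊖ B) ≡ + k * (+ k' * det u' u)
segData-det {A} {B} {C} {u} {k} {u'} {k'} sd (_ , _ , C-B) = begin
  det (A ⊖ B) (C ⊖ B)             ≡⟨ cong₂ det A-B C-B ⟩
  det (+ k • neg u) (+ k' • u')   ≡⟨ det-•• (+ k) (+ k') (neg u) u' ⟩
  + k * (+ k' * det (neg u) u')   ≡⟨ cong (λ t → + k * (+ k' * t)) (det-negˡ u u') ⟩
  + k * (+ k' * det u' u)         ∎
  where
  A-B : A ⊖ B ≡ + k • neg u
  A-B = proj₂ (proj₂ (segData-reverse {A} {B} {u} {k} sd))

lsinTan-det : ∀ {X Y Z x₁ x₂ v₁ k₁ v₂ k₂} → SegData Y X v₁ k₁ → SegData Y Z v₂ k₂ →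
  LSinTan X Y Z x₁ x₂ → det v₁ v₂ ≡ x₂ * sgnℤ (det v₁ v₂)
lsinTan-det {X} {Y} {Z} {x₁} {x₂} {v₁} {k₁} {v₂} {k₂} sd₁ sd₂
  (_ , v₁' , v₂' , D , k₁' , k₂' , sd₁' , sd₂' , onL , _ , _ , dec)
  with segData-unique {Y} {X} {v₁'} {k₁'} {v₁} {k₁} sd₁' sd₁
     | segData-unique {Y} {Z} {v₂'} {k₂'} {v₂} {k₂} sd₂' sd₂
... | refl , refl | refl , refl =
  trans (cong (det v₁) dec) (trans (det-lincombʳ v₁ x₁ x₂ (D ⊖ Y)) (cong (x₂ *_) onL))

sgn-lsin : ∀ {A B C u k u' k' σ} → SegData A B u k → SegData B C u' k' → LSin A B C σ →
  sgn A B C * σ ≡ det u' u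
sgn-lsin {A} {B} {C} {u} {suc k} {u'} {suc k'} {σ} sd@(_ , s≤s _ , _) sd'@(_ , s≤s _ , _) = from-lsin
  where
  det-ABC : det (A ⊖ B) (C ⊖ B) ≡ +[1+ k ] * (+[1+ k' ] * det u' u)
  det-ABC = segData-det {A} {B} {C} {u} {suc k} {u'} {suc k'} sd sd'
  from-lsin : LSin A B C σ → sgn A B C * σ ≡ det u' u
  from-lsin (inj₁ (col , σ≡0)) = begin
    sgn A B C * σ    ≡⟨ cong (sgn A B C *_) σ≡0 ⟩
    sgn A B C * 0ℤ   ≡⟨ ℤP.*-zeroʳ (sgn A B C) ⟩
    0ℤ               ≡⟨ sym (pos*≡0 k' (pos*≡0 k (trans (sym det-ABC) col))) ⟩
    det u' u         ∎
  from-lsin (inj₂ (x₁ , tan)) = begin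
    sgn A B C * σ         ≡⟨ cong (_* σ) sgn-ABC ⟩
    sgnℤ (det u' u) * σ   ≡⟨ ℤP.*-comm _ σ ⟩
    σ * sgnℤ (det u' u)   ≡⟨ sym (subst (λ δ → δ ≡ σ * sgnℤ δ) (det-negˡ u u') tan-det) ⟩
    det u' u              ∎
    where
    sgn-ABC : sgn A B C ≡ sgnℤ (det u' u)
    sgn-ABC = trans (cong sgnℤ det-ABC) (trans (sgnℤ-pos* k (+[1+ k' ] * det u' u)) (sgnℤ-pos* k' (det u' u)))
    tan-det : det (neg u) u' ≡ σ * sgnℤ (det (neg u) u')
    tan-det = lsinTan-det {A} {B} {C} {x₁} {σ} {neg u} {suc k} {u'} {suc k'}
                (segData-reverse {A} {B} {u} {suc k} sd) sd' tan

unitSeg-det : ∀ {V A B u k} → SegData A B u k → UnitSeg V A B →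
  det (A ⊖ V) u ≡ sgn A V B × Unit (sgn A V B)
unitSeg-det {V} {A} {B} {u} {suc k} sd@(_ , s≤s _ , _) (u' , k' , sd' , unit')
  with segData-unique {A} {B} {u'} {k'} {u} {suc k} sd' sd
... | refl , refl = d≡sgn , subst Unit d≡sgn unitD
  where
  unitD : Unit (det (A ⊖ V) u)
  unitD = subst Unit (det-swap-⊖ u A V) unit'
  d≡sgn : det (A ⊖ V) u ≡ sgn A V B
  d≡sgn = sym (begin
    sgnℤ (det (A ⊖ V) (B ⊖ V))
      ≡⟨ cong (sgnℤ ∘ det (A ⊖ V)) (segData-⊖ V {A} {B} {u} {suc k} sd) ⟩
    sgnℤ (det (A ⊖ V) ((A ⊖ V) ⊕ (+[1+ k ] • u)))  ≡⟨ cong sgnℤ (det-⊕•ʳ (A ⊖ V) +[1+ k ] u) ⟩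
    sgnℤ (+[1+ k ] * det (A ⊖ V) u)                ≡⟨ sgnℤ-pos* k (det (A ⊖ V) u) ⟩
    sgnℤ (det (A ⊖ V) u)                           ≡⟨ sgnℤ-unit unitD ⟩
    det (A ⊖ V) u                                  ∎)

frame-det : ∀ {V A B u k} → SegData A B u k → UnitSeg V A B → det (A ⊖ V) (sgn A V B • u) ≡ 1ℤ
frame-det {V} {A} {B} {u} {k} sd us = begin
  det (A ⊖ V) (sgn A V B • u)   ≡⟨ det-•ʳ (A ⊖ V) (sgn A V B) u ⟩
  sgn A V B * det (A ⊖ V) u     ≡⟨ cong (sgn A V B *_) (proj₁ orientation) ⟩
  sgn A V B * sgn A V B         ≡⟨ unit-square (proj₂ orientation) ⟩
  1ℤ                            ∎
  where
  orientation : det (A ⊖ V) u ≡ sgn A V B × Unit (sgn A V B)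
  orientation = unitSeg-det {V} {A} {B} {u} {k} sd us

segment-step : ∀ {V A B u k ε} → SegData A B u k → Unit ε →
  (A ⊖ V) ⊕ ((ε * + k) • (ε • u)) ≡ B ⊖ V
segment-step {V} {A} {B} {u} {k} sd ε-unit =
  trans (cong ((A ⊖ V) ⊕_) (unit-•-cancel ε-unit (+ k) u)) (sym (segData-⊖ V {A} {B} {u} {k} sd))

frame-turn : ∀ {V A B C u k u' k' σ} → SegData A B u k → SegData B C u' k' → LSin A B C σ →
  UnitSeg V A B → UnitSeg V B C →
  sgn B V C • u' ≡ (sgn A V B • u) ⊕ ((sgn A V B * sgn B V C * sgn A B C * σ) • (B ⊖ V))
frame-turn {V} {A} {B} {C} {u} {k} {u'} {k'} {σ} sd sd' lsin usAB usBC =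
  trans (basis-change {B ⊖ V} {ε • u} {ε' • u'} frame-at-B (frame-det {V} {B} {C} {u'} {k'} sd' usBC))
        (cong (λ a → (ε • u) ⊕ (a • (B ⊖ V))) turn)
  where
  ε ε' : ℤ
  ε  = sgn A V B
  ε' = sgn B V C
  frame-at-B : det (B ⊖ V) (ε • u) ≡ 1ℤ
  frame-at-B = begin
    det (B ⊖ V) (ε • u)                  ≡⟨ cong (λ X → det X (ε • u)) (segData-⊖ V {A} {B} {u} {k} sd) ⟩
    det ((A ⊖ V) ⊕ (+ k • u)) (ε • u)    ≡⟨ det-•ʳ ((A ⊖ V) ⊕ (+ k • u)) ε u ⟩
    ε * det ((A ⊖ V) ⊕ (+ k • u)) u      ≡⟨ cong (ε *_) (det-⊕•ˡ (A ⊖ V) (+ k) u) ⟩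
    ε * det (A ⊖ V) u                    ≡⟨ sym (det-•ʳ (A ⊖ V) ε u) ⟩
    det (A ⊖ V) (ε • u)                  ≡⟨ frame-det {V} {A} {B} {u} {k} sd usAB ⟩
    1ℤ                                   ∎
  reassoc : ∀ a b c d → a * (b * (c * d)) ≡ b * a * c * d
  reassoc = solve-∀
  turn : det (ε' • u') (ε • u) ≡ ε * ε' * sgn A B C * σ
  turn = begin
    det (ε' • u') (ε • u)        ≡⟨ det-•• ε' ε u' u ⟩
    ε' * (ε * det u' u)
      ≡⟨ cong (λ t → ε' * (ε * t)) (sym (sgn-lsin {A} {B} {C} {u} {k} {u'} {k'} {σ} sd sd' lsin)) ⟩
    ε' * (ε * (sgn A B C * σ))   ≡⟨ reassoc ε' ε (sgn A B C) σ ⟩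
    ε * ε' * sgn A B C * σ       ∎

slide shear : ℤ → Pt × Pt → Pt × Pt
slide a (P , w) = P ⊕ (a • w) , w
shear b (P , w) = P , w ⊕ (b • P)

walk : Pt × Pt → List ℤ → Pt × Pt
walk F []          = F
walk F (a ∷ [])    = slide a F
walk F (a ∷ b ∷ s) = walk (shear b (slide a F)) s

sls-headSeg : ∀ {V A B l s} → SLS V (A ∷ B ∷ l) s → ∃₂ λ u k → SegData A B u k
sls-headSeg (last-seg sd) = _ , _ , sd
sls-headSeg (more sd _ _) = _ , _ , sd

walk-last : ∀ {V A B l s u k} → SLS V (A ∷ B ∷ l) s → UnitDist V (A ∷ B ∷ l) → SegData A B u k →
  last (A ∷ B ∷ l) ≡ just (V ⊕ proj₁ (walk (A ⊖ V , sgn A V B • u) s))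
walk-last {V} {A} {B} {u = u} {k} (last-seg {u = u'} {k'} sd') (usAB , _) sd
  with segData-unique {A} {B} {u'} {k'} {u} {k} sd' sd
... | refl , refl = cong just (sym (trans (cong (V ⊕_) step) (⊕-⊖-inverse V B)))
  where
  step : (A ⊖ V) ⊕ ((sgn A V B * + k) • (sgn A V B • u)) ≡ B ⊖ V
  step = segment-step {V} {A} {B} {u} {k} sd (proj₂ (unitSeg-det {V} {A} {B} {u} {k} sd usAB))
walk-last {V} {A} {B} {C ∷ l} {u = u} {k} (more {s = s} {u'} {k'} {σ} sd' lsin sls) (usAB , ud) sd
  with segData-unique {A} {B} {u'} {k'} {u} {k} sd' sd
... | refl , refl =
  trans (walk-last {V} {B} {C} {l} {s} {u''} {k''} sls ud sd'')
        (cong (λ F → just (V ⊕ proj₁ (walk F s))) (cong₂ _,_ (sym step) turn))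
  where
  ε a₀ a₁ : ℤ
  ε  = sgn A V B
  a₀ = ε * + k
  a₁ = ε * sgn B V C * sgn A B C * σ
  next : ∃₂ λ u k → SegData B C u k
  next = sls-headSeg sls
  u'' : Pt
  u'' = proj₁ next
  k'' : ℕ
  k'' = proj₁ (proj₂ next)
  sd'' : SegData B C u'' k''
  sd'' = proj₂ (proj₂ next)
  step : (A ⊖ V) ⊕ (a₀ • (ε • u)) ≡ B ⊖ V
  step = segment-step {V} {A} {B} {u} {k} sd (proj₂ (unitSeg-det {V} {A} {B} {u} {k} sd usAB))
  turn : sgn B V C • u'' ≡ (ε • u) ⊕ (a₁ • ((A ⊖ V) ⊕ (a₀ • (ε • u))))
  turn = trans (frame-turn {V} {A} {B} {C} {u} {k} {u''} {k''} {σ} sd sd'' lsin usAB (proj₁ ud))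
               (cong (λ X → (ε • u) ⊕ (a₁ • X)) (sym step))

walk-traces : ∀ {V A B l s} → SLS V (A ∷ B ∷ l) s → UnitDist V (A ∷ B ∷ l) →
  ∃[ w ] det (A ⊖ V) w ≡ 1ℤ × last (A ∷ B ∷ l) ≡ just (V ⊕ proj₁ (walk (A ⊖ V , w) s))
walk-traces {V} {A} {B} {l} {s} sls ud with sls-headSeg sls
... | u , k , sd =
  _ , frame-det {V} {A} {B} {u} {k} sd (proj₁ ud) , walk-last {V} {A} {B} {l} {s} {u} {k} sls ud sd

Even : List ℤ → Set
Even cs = ∃[ r ] length cs ≡ 2 ℕ.* r

even-drop₂ : ∀ {n} → ∃[ r ] suc (suc n) ≡ 2 ℕ.* r → ∃[ r ] n ≡ 2 ℕ.* r
even-drop₂ (zero , ())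
even-drop₂ (suc r , e) = r , ℕP.suc-injective (trans (ℕP.suc-injective e) (ℕP.+-suc r (r ℕ.+ 0)))

one-not-even : ¬ (∃[ r ] 1 ≡ 2 ℕ.* r)
one-not-even (zero , ())
one-not-even (suc r , e) with trans (ℕP.suc-injective e) (ℕP.+-suc r (r ℕ.+ 0))
... | ()

cfNum cfDen : ℤ → List ℤ → ℤ
cfNum c cs = proj₁ (cf c cs)
cfDen c cs = proj₂ (cf c cs)

slide-det : ∀ a F → uncurry det (slide a F) ≡ uncurry det F
slide-det a (P , w) = det-⊕•ˡ P a w

shear-det : ∀ b F → uncurry det (shear b F) ≡ uncurry det F
shear-det b (P , w) = det-shear P b w

walk-det : ∀ F s → uncurry det (walk F s) ≡ uncurry det F
walk-det F []          = refl
walk-det F (a ∷ [])    = slide-det a F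
walk-det F (a ∷ b ∷ s) = trans (walk-det _ s) (trans (shear-det b (slide a F)) (slide-det a F))

-- Since c ∷ cs has odd length, the entry b following it is a sine entry of the walk.
walk-++ : ∀ F c cs b t → Even cs →
  walk F ((c ∷ cs) ++ b ∷ t) ≡ walk (shear b (walk F (c ∷ cs))) t
walk-++ F c []             b t _  = refl
walk-++ F c (_ ∷ [])       b t ev = ⊥-elim (one-not-even ev)
walk-++ F c (c₁ ∷ c₂ ∷ cs) b t ev = walk-++ (shear c₁ (slide c F)) c₂ cs b t (even-drop₂ ev)

walk-cf : ∀ P w c cs → Even cs →
  proj₁ (walk (P , w) (c ∷ cs)) ≡ (cfDen c cs • P) ⊕ (cfNum c cs • w)
walk-cf P w c []             _  = cong (_⊕ (c • w)) (sym (•-identityˡ P))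
walk-cf P w c (_ ∷ [])       ev = ⊥-elim (one-not-even ev)
walk-cf P w c (c₁ ∷ c₂ ∷ cs) ev = begin
  proj₁ (walk (P' , w') (c₂ ∷ cs))                              ≡⟨ walk-cf P' w' c₂ cs (even-drop₂ ev) ⟩
  (cfDen c₂ cs • P') ⊕ (cfNum c₂ cs • w')                       ≡⟨ cf-step P w c c₁ (cfNum c₂ cs) (cfDen c₂ cs) ⟩
  (cfDen c (c₁ ∷ c₂ ∷ cs) • P) ⊕ (cfNum c (c₁ ∷ c₂ ∷ cs) • w)   ∎
  where
  P' w' : Pt
  P' = P ⊕ (c • w)
  w' = w ⊕ (c₁ • P')

1≤⇒pos : ∀ {c} → 1ℤ ℤ.≤ c → Pos c
1≤⇒pos (+≤+ (s≤s {n = n} _)) = n , refl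

cf-pos : ∀ c cs → Pos c → AllPos cs → Pos (cfNum c cs) × Pos (cfDen c cs)
cf-pos c []       c-pos      _               = c-pos , 0 , refl
cf-pos c (d ∷ ds) (n , refl) (1≤d , ds-pos) with cf-pos d ds (1≤⇒pos 1≤d) ds-pos
... | (m , num≡) , (_ , den≡) = (_ , cong₂ (λ x y → +[1+ n ] * x + y) num≡ den≡) , (m , num≡)

cfDen-pos : ∀ c cs → AllPos cs → Pos (cfDen c cs)
cfDen-pos c []       _               = 0 , refl
cfDen-pos c (d ∷ ds) (1≤d , ds-pos) = proj₁ (cf-pos d ds (1≤⇒pos 1≤d) ds-pos)

-- (v , d) is the basis (v₁ , D - Y) of the lattice-sine construction; in it the second
-- ray has direction (x₁ , x₂).
record AngleFrame (X Y Z : Pt) (x₁ x₂ : ℤ) : Set where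
  field
    v d        : Pt
    k₁ k₂      : ℕ
    unimodular : Unit (det v d)
    X-ray      : X ⊖ Y ≡ +[1+ k₁ ] • v
    Z-ray      : Z ⊖ Y ≡ +[1+ k₂ ] • ((x₁ • v) ⊕ (x₂ • d))
    x₁-pos     : Pos x₁
    x₂-pos     : Pos x₂

-- The condition that D lies on the other side of the line YZ from X, in the coordinates of
-- lsinTan-frame below: it forces x₁ > 0.
opposite-side-pos : ∀ {x y ε} k → Unit ε → Pos y →
  sgnℤ (x * ε) ≡ - sgnℤ (+[1+ k ] * - (y * ε)) → Pos x
opposite-side-pos {+[1+ n ]} _ _           _          _ = n , refl
opposite-side-pos {+ zero}   _ (inj₁ refl) (_ , refl) ()
opposite-side-pos { -[1+ _ ]} _ (inj₁ refl) (_ , refl) ()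
opposite-side-pos {+ zero}   _ (inj₂ refl) (_ , refl) ()
opposite-side-pos { -[1+ _ ]} _ (inj₂ refl) (_ , refl) ()

lsinTan-frame : ∀ {X Y Z x₁ x₂} → LSinTan X Y Z x₁ x₂ → AngleFrame X Y Z x₁ x₂
lsinTan-frame {X} {Y} {Z} {x₁} {x₂}
  tan@(ncol , v₁ , v₂ , D , suc k₁ , suc k₂ , sd₁@(_ , _ , X-Y) , sd₂@(_ , _ , Z-Y) ,
       onL , otherSide , _ , dec) =
  record
    { v = v₁ ; d = d ; k₁ = k₁ ; k₂ = k₂
    ; unimodular = subst Unit (sym onL) (proj₁ sign)
    ; X-ray      = X-Y
    ; Z-ray      = trans Z-Y (cong (+[1+ k₂ ] •_) dec)
    ; x₁-pos     = opposite-side-pos k₁ (proj₁ sign) (proj₂ sign) side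
    ; x₂-pos     = proj₂ sign
    }
  where
  d : Pt
  d = D ⊖ Y
  δ ε : ℤ
  δ = det v₁ v₂
  ε = sgnℤ δ
  δ≡x₂ε : δ ≡ x₂ * ε
  δ≡x₂ε = lsinTan-det {X} {Y} {Z} {x₁} {x₂} {v₁} {suc k₁} {v₂} {suc k₂} sd₁ sd₂ tan
  δ≢0 : δ ≢ 0ℤ
  δ≢0 δ≡0 = ncol (begin
    det (X ⊖ Y) (Z ⊖ Y)                      ≡⟨ cong₂ det X-Y Z-Y ⟩
    det (+[1+ k₁ ] • v₁) (+[1+ k₂ ] • v₂)    ≡⟨ det-•• +[1+ k₁ ] +[1+ k₂ ] v₁ v₂ ⟩
    +[1+ k₁ ] * (+[1+ k₂ ] * δ)              ≡⟨ cong (λ t → +[1+ k₁ ] * (+[1+ k₂ ] * t)) δ≡0 ⟩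
    +[1+ k₁ ] * (+[1+ k₂ ] * 0ℤ)             ≡⟨ cong (+[1+ k₁ ] *_) (ℤP.*-zeroʳ +[1+ k₂ ]) ⟩
    +[1+ k₁ ] * 0ℤ                           ≡⟨ ℤP.*-zeroʳ +[1+ k₁ ] ⟩
    0ℤ                                       ∎)
  sign : Unit ε × Pos x₂
  sign = sgnℤ-factor δ≢0 δ≡x₂ε
  v₂∧d : det v₂ d ≡ x₁ * ε
  v₂∧d = trans (cong (λ t → det t d) dec) (trans (det-lincombˡ v₁ x₁ x₂ d) (cong (x₁ *_) onL))
  v₂∧X : det v₂ (X ⊖ Y) ≡ +[1+ k₁ ] * - (x₂ * ε)
  v₂∧X = begin
    det v₂ (X ⊖ Y)               ≡⟨ cong (det v₂) X-Y ⟩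
    det v₂ (+[1+ k₁ ] • v₁)      ≡⟨ det-•ʳ v₂ +[1+ k₁ ] v₁ ⟩
    +[1+ k₁ ] * det v₂ v₁        ≡⟨ cong (+[1+ k₁ ] *_) (trans (det-anti v₂ v₁) (cong -_ δ≡x₂ε)) ⟩
    +[1+ k₁ ] * - (x₂ * ε)       ∎
  side : sgnℤ (x₁ * ε) ≡ - sgnℤ (+[1+ k₁ ] * - (x₂ * ε))
  side = begin
    sgnℤ (x₁ * ε)                        ≡⟨ cong sgnℤ (sym v₂∧d) ⟩
    sgnℤ (det v₂ d)                      ≡⟨ otherSide ⟩
    - sgnℤ (det v₂ (X ⊖ Y))              ≡⟨ cong (-_ ∘ sgnℤ) v₂∧X ⟩
    - sgnℤ (+[1+ k₁ ] * - (x₂ * ε))      ∎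

linear : LAff → Pt → Pt
linear (laff a b c d _ _) (x , y) = (a * x + b * y , c * x + d * y)

-- The lattice-affine map T + x P + y w ↦ Y + x v + y d (for det P w = 1): its linear part
-- is the matrix (v d) times the adjugate of (P w).
frameMap : (T P w Y v d : Pt) → LAff
frameMap (t₁ , t₂) (p₁ , p₂) (w₁ , w₂) (y₁ , y₂) (v₁ , v₂) (d₁ , d₂) =
  laff m₁₁ m₁₂ m₂₁ m₂₂ (y₁ - (m₁₁ * t₁ + m₁₂ * t₂)) (y₂ - (m₂₁ * t₁ + m₂₂ * t₂))
  where
  m₁₁ m₁₂ m₂₁ m₂₂ : ℤ
  m₁₁ = w₂ * v₁ - p₂ * d₁
  m₁₂ = p₁ * d₁ - w₁ * v₁
  m₂₁ = w₂ * v₂ - p₂ * d₂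
  m₂₂ = p₁ * d₂ - w₁ * v₂

apply-frameMap : ∀ T P w Y v d X →
  apply (frameMap T P w Y v d) X ≡ Y ⊕ ((det (X ⊖ T) w • v) ⊕ (det P (X ⊖ T) • d))
apply-frameMap (t₁ , t₂) (p₁ , p₂) (w₁ , w₂) (y₁ , y₂) (v₁ , v₂) (d₁ , d₂) (x₁ , x₂) =
  cong₂ _,_ (eq t₁ t₂ p₁ p₂ w₁ w₂ y₁ v₁ d₁ x₁ x₂) (eq t₁ t₂ p₁ p₂ w₁ w₂ y₂ v₂ d₂ x₁ x₂)
  where
  eq : ∀ t₁ t₂ p₁ p₂ w₁ w₂ y v d x₁ x₂ →
    (w₂ * v - p₂ * d) * x₁ + (p₁ * d - w₁ * v) * x₂ + (y - ((w₂ * v - p₂ * d) * t₁ + (p₁ * d - w₁ * v) * t₂))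
      ≡ y + (((x₁ - t₁) * w₂ - (x₂ - t₂) * w₁) * v + (p₁ * (x₂ - t₂) - p₂ * (x₁ - t₁)) * d)
  eq = solve-∀

frameMap-origin : ∀ T P w Y v d → apply (frameMap T P w Y v d) T ≡ Y
frameMap-origin T P w Y v d = ⊕-⊖-inverse (linear (frameMap T P w Y v d) T) Y

detM-frameMap : ∀ T P w Y v d → detM (frameMap T P w Y v d) ≡ det v d * det P w
detM-frameMap (t₁ , t₂) (p₁ , p₂) (w₁ , w₂) (y₁ , y₂) (v₁ , v₂) (d₁ , d₂) = eq p₁ p₂ w₁ w₂ v₁ v₂ d₁ d₂
  where
  eq : ∀ p₁ p₂ w₁ w₂ v₁ v₂ d₁ d₂ →
    (w₂ * v₁ - p₂ * d₁) * (p₁ * d₂ - w₁ * v₂) - (p₁ * d₁ - w₁ * v₁) * (w₂ * v₂ - p₂ * d₂)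
      ≡ (v₁ * d₂ - v₂ * d₁) * (p₁ * w₂ - p₂ * w₁)
  eq = solve-∀

frameMap-coords : ∀ T P w Y v d {X x y} → det P w ≡ 1ℤ → X ⊖ T ≡ (x • P) ⊕ (y • w) →
  apply (frameMap T P w Y v d) X ⊖ Y ≡ (x • v) ⊕ (y • d)
frameMap-coords T P w Y v d {X} {x} {y} dPw X-T = begin
  apply (frameMap T P w Y v d) X ⊖ Y                       ≡⟨ cong (_⊖ Y) (apply-frameMap T P w Y v d X) ⟩
  (Y ⊕ ((det (X ⊖ T) w • v) ⊕ (det P (X ⊖ T) • d))) ⊖ Y   ≡⟨ ⊕-⊖-cancelˡ Y _ ⟩
  (det (X ⊖ T) w • v) ⊕ (det P (X ⊖ T) • d)
    ≡⟨ cong₂ (λ a b → (a • v) ⊕ (b • d)) (det-coord₁ P w x y dPw X-T) (det-coord₂ P w x y dPw X-T) ⟩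
  (x • v) ⊕ (y • d)                                        ∎

sameRay : ∀ {Y Q R m n} → Pos m → Pos n → m • (Q ⊖ Y) ≡ n • (R ⊖ Y) → SameRay Y Q Y R
sameRay (i , refl) (j , refl) e = suc i , suc j , s≤s z≤n , s≤s z≤n , e

angleFrame-congruent : ∀ {X Y Z n x₁ x₂ p q a b P w T X' Z' nc} →
  AngleFrame X Y Z x₁ x₂ → p * x₁ ≡ q * x₂ → Pos p → Pos a → Pos b → det P w ≡ 1ℤ →
  X' ⊖ T ≡ a • P → Z' ⊖ T ≡ b • ((q • P) ⊕ (p • w)) →
  LatticeCongruent (∠ X' T Z' nc) (∠ X Y Z n)
angleFrame-congruent {X} {Y} {Z} {_} {x₁} {x₂} {p} {q} {a} {b} {P} {w} {T} {X'} {Z'}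
  F prop p-pos a-pos b-pos dPw X'-T Z'-T =
  f , f-unimodular , frameMap-origin T P w Y v d , X-sameRay , Z-sameRay
  where
  open AngleFrame F
  f : LAff
  f = frameMap T P w Y v d
  f-unimodular : IsLatticeAffine f
  f-unimodular = subst Unit
    (sym (trans (detM-frameMap T P w Y v d) (trans (cong (det v d *_) dPw) (ℤP.*-identityʳ _))))
    unimodular
  image-X' : apply f X' ⊖ Y ≡ (a • v) ⊕ (0ℤ • d)
  image-X' = frameMap-coords T P w Y v d {X'} {a} {0ℤ} dPw (trans X'-T (•-as-lincomb a P w))
  image-Z' : apply f Z' ⊖ Y ≡ ((b * q) • v) ⊕ ((b * p) • d)
  image-Z' = frameMap-coords T P w Y v d {Z'} {b * q} {b * p} dPw (trans Z'-T (•-lincomb b q p P w))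
  X-sameRay : SameRay Y (apply f X') Y X
  X-sameRay = sameRay {Y} {apply f X'} {X} (k₁ , refl) a-pos (begin
    +[1+ k₁ ] • (apply f X' ⊖ Y)       ≡⟨ cong (+[1+ k₁ ] •_) image-X' ⟩
    +[1+ k₁ ] • ((a • v) ⊕ (0ℤ • d))   ≡⟨ •-ray +[1+ k₁ ] a v d ⟩
    a • (+[1+ k₁ ] • v)                ≡⟨ cong (a •_) (sym X-ray) ⟩
    a • (X ⊖ Y)                        ∎)
  Z-sameRay : SameRay Y (apply f Z') Y Z
  Z-sameRay = sameRay {Y} {apply f Z'} {Z} (pos-* (k₂ , refl) x₂-pos) (pos-* b-pos p-pos) (begin
    (+[1+ k₂ ] * x₂) • (apply f Z' ⊖ Y)                  ≡⟨ cong ((+[1+ k₂ ] * x₂) •_) image-Z' ⟩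
    (+[1+ k₂ ] * x₂) • (((b * q) • v) ⊕ ((b * p) • d))
      ≡⟨ proportional-rays {p} {x₁} {q} {x₂} prop +[1+ k₂ ] b v d ⟩
    (b * p) • (+[1+ k₂ ] • ((x₁ • v) ⊕ (x₂ • d)))        ≡⟨ cong ((b * p) •_) (sym Z-ray) ⟩
    (b * p) • (Z ⊖ Y)                                    ∎)

rays-nonCollinear : ∀ {p q a b P w T X' Z'} → Pos p → Pos a → Pos b → det P w ≡ 1ℤ →
  X' ⊖ T ≡ a • P → Z' ⊖ T ≡ b • ((q • P) ⊕ (p • w)) → ¬ Collinear X' T Z'
rays-nonCollinear {p} {q} {a} {b} {P} {w} {T} {X'} {Z'} p-pos a-pos b-pos dPw X'-T Z'-T col =
  pos≢0 (pos-* a-pos (pos-* b-pos p-pos)) (trans (sym det-rays) col)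
  where
  det-rays : det (X' ⊖ T) (Z' ⊖ T) ≡ a * (b * p)
  det-rays = begin
    det (X' ⊖ T) (Z' ⊖ T)                   ≡⟨ cong₂ det X'-T Z'-T ⟩
    det (a • P) (b • ((q • P) ⊕ (p • w)))   ≡⟨ det-•• a b P _ ⟩
    a * (b * det P ((q • P) ⊕ (p • w)))     ≡⟨ cong (λ t → a * (b * t)) (det-coord₂ P w q p dPw refl) ⟩
    a * (b * p)                             ∎

angleSeq-cfNum-pos : ∀ {α c cs} → AngleSeq α (c ∷ cs) → Pos (cfNum c cs)
angleSeq-cfNum-pos {∠ X Y Z _} {c} {cs} (_ , cs-pos , x₁ , x₂ , tan , prop) =
  pos-of-proportion x₁-pos (cfDen-pos c cs cs-pos) x₂-pos prop
  where
  open AngleFrame (lsinTan-frame {X} {Y} {Z} {x₁} {x₂} tan)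

angleSeq-corner : ∀ {α c cs a b P w T X' Z'} → AngleSeq α (c ∷ cs) →
  Pos a → Pos b → det P w ≡ 1ℤ →
  X' ⊖ T ≡ a • P → Z' ⊖ T ≡ b • ((cfDen c cs • P) ⊕ (cfNum c cs • w)) →
  Σ (¬ Collinear X' T Z') λ nc → LatticeCongruent (∠ X' T Z' nc) α
angleSeq-corner {∠ X Y Z n} {c} {cs} {a} {b} {P} {w} {T} {X'} {Z'}
  aS@(_ , _ , x₁ , x₂ , tan , prop) a-pos b-pos dPw X'-T Z'-T =
  nc , angleFrame-congruent {X} {Y} {Z} {n} {x₁} {x₂} {p} {q} {a} {b} {P} {w} {T} {X'} {Z'} {nc}
         (lsinTan-frame tan) prop p-pos a-pos b-pos dPw X'-T Z'-T
  where
  p q : ℤ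
  p = cfNum c cs
  q = cfDen c cs
  p-pos : Pos p
  p-pos = angleSeq-cfNum-pos {∠ X Y Z n} aS
  nc : ¬ Collinear X' T Z'
  nc = rays-nonCollinear {p} {q} {a} {b} {P} {w} {T} {X'} {Z'} p-pos a-pos b-pos dPw X'-T Z'-T

TriangleWithAngles : Angle → Angle → Angle → Set
TriangleWithAngles α β γ = Σ Pt λ A → Σ Pt λ B → Σ Pt λ C →
  Σ (¬ Collinear A B C) λ nABC → Σ (¬ Collinear C A B) λ nCAB → Σ (¬ Collinear B C A) λ nBCA →
    LatticeCongruent (∠ C A B nCAB) α
    × LatticeCongruent (∠ A B C nABC) β
    × LatticeCongruent (∠ B C A nBCA) γ

closing-relation : ∀ {P w Pa wa Pb wb pα qα pβ qβ pγ qγ} →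
  det P w ≡ 1ℤ → det Pa wa ≡ 1ℤ → det Pb wb ≡ 1ℤ →
  Pa ≡ (qα • P) ⊕ (pα • w) → Pb ≡ (qβ • Pa) ⊕ (pβ • wa) → neg P ≡ (qγ • Pb) ⊕ (pγ • wb) →
  (pβ • P) ⊕ (pα • Pb) ≡ pγ • Pa
closing-relation {P} {w} {Pa} {wa} {Pb} {wb} {pα} {qα} {pβ} {qβ} {pγ} {qγ} dP dPa dPb ePa ePb eP = begin
  (pβ • P) ⊕ (pα • Pb)                ≡⟨ cong₂ (λ s t → (s • P) ⊕ (t • Pb)) (sym det-Pa-Pb) (sym det-P-Pa) ⟩
  (det Pa Pb • P) ⊕ (det P Pa • Pb)   ≡⟨ plücker P Pa Pb ⟩
  det P Pb • Pa                       ≡⟨ cong (_• Pa) det-P-Pb ⟩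
  pγ • Pa                             ∎
  where
  det-P-Pa : det P Pa ≡ pα
  det-P-Pa = det-coord₂ P w qα pα dP ePa
  det-Pa-Pb : det Pa Pb ≡ pβ
  det-Pa-Pb = det-coord₂ Pa wa qβ pβ dPa ePb
  det-P-Pb : det P Pb ≡ pγ
  det-P-Pb = trans (sym (det-negʳ Pb P)) (det-coord₂ Pb wb qγ pγ dPb eP)

triangle-of-frames : ∀ {α β γ cα csα cβ csβ cγ csγ P w Pa wa Pb wb} →
  AngleSeq α (cα ∷ csα) → AngleSeq β (cβ ∷ csβ) → AngleSeq γ (cγ ∷ csγ) →
  det P w ≡ 1ℤ → det Pa wa ≡ 1ℤ → det Pb wb ≡ 1ℤ →
  Pa ≡ (cfDen cα csα • P) ⊕ (cfNum cα csα • w) →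
  Pb ≡ (cfDen cβ csβ • Pa) ⊕ (cfNum cβ csβ • wa) →
  neg P ≡ (cfDen cγ csγ • Pb) ⊕ (cfNum cγ csγ • wb) →
  TriangleWithAngles α β γ
triangle-of-frames {α} {β} {γ} {cα} {csα} {cβ} {csβ} {cγ} {csγ} {P} {w} {Pa} {wa} {Pb} {wb}
  aα aβ aγ dP dPa dPb ePa ePb eP =
  O , B , C , proj₁ atB , proj₁ atA , proj₁ atC , proj₂ atA , proj₂ atB , proj₂ atC
  where
  pα pβ pγ qβ : ℤ
  pα = cfNum cα csα
  pβ = cfNum cβ csβ
  pγ = cfNum cγ csγ
  qβ = cfDen cβ csβ
  B C : Pt
  B = pγ • Pa
  C = pβ • P
  pα-pos : Pos pα
  pα-pos = angleSeq-cfNum-pos {α} aα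
  pβ-pos : Pos pβ
  pβ-pos = angleSeq-cfNum-pos {β} aβ
  pγ-pos : Pos pγ
  pγ-pos = angleSeq-cfNum-pos {γ} aγ
  closing : C ⊕ (pα • Pb) ≡ B
  closing = closing-relation {P} {w} {Pa} {wa} {Pb} {wb}
              {pα} {cfDen cα csα} {pβ} {qβ} {pγ} {cfDen cγ csγ} dP dPa dPb ePa ePb eP
  atA : Σ (¬ Collinear C O B) λ nc → LatticeCongruent (∠ C O B nc) α
  atA = angleSeq-corner {α} {cα} {csα} {pβ} {pγ} {P} {w} {O} {C} {B} aα pβ-pos pγ-pos dP
    (⊖-identityʳ C) (trans (⊖-identityʳ B) (cong (pγ •_) ePa))
  atB : Σ (¬ Collinear O B C) λ nc → LatticeCongruent (∠ O B C nc) β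
  atB = angleSeq-corner {β} {cβ} {csβ} {pγ} {pα} {neg Pa} {neg wa} {B} {O} {C} aβ pγ-pos pα-pos
    (trans (det-neg Pa wa) dPa)
    (trans (O⊖≡neg B) (neg-• pγ Pa)) (begin
      C ⊖ B                                   ≡⟨ cong (C ⊖_) (sym closing) ⟩
      C ⊖ (C ⊕ (pα • Pb))                     ≡⟨ ⊖-⊕-cancelˡ C _ ⟩
      neg (pα • Pb)                           ≡⟨ neg-• pα Pb ⟩
      pα • neg Pb                             ≡⟨ cong (λ X → pα • neg X) ePb ⟩
      pα • neg ((qβ • Pa) ⊕ (pβ • wa))        ≡⟨ cong (pα •_) (neg-lincomb qβ pβ Pa wa) ⟩
      pα • ((qβ • neg Pa) ⊕ (pβ • neg wa))    ∎)
  atC : Σ (¬ Collinear B C O) λ nc → LatticeCongruent (∠ B C O nc) γ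
  atC = angleSeq-corner {γ} {cγ} {csγ} {pα} {pβ} {Pb} {wb} {C} {B} {O} aγ pα-pos pβ-pos dPb
    (trans (cong (_⊖ C) (sym closing)) (⊕-⊖-cancelˡ C _))
    (trans (O⊖≡neg C) (trans (neg-• pβ P) (cong (pβ •_) eP)))

triangle-of-walk : ∀ {α β γ sα sβ sγ u v P w} →
  AngleSeq α sα → AngleSeq β sβ → AngleSeq γ sγ → det P w ≡ 1ℤ →
  proj₁ (walk (P , w) (sα ++ u ∷ sβ ++ v ∷ sγ)) ≡ neg P → TriangleWithAngles α β γ
triangle-of-walk {sα = []} () _ _ _ _
triangle-of-walk {sβ = []} _ () _ _ _
triangle-of-walk {sγ = []} _ _ () _ _
triangle-of-walk {α} {β} {γ} {cα ∷ csα} {cβ ∷ csβ} {cγ ∷ csγ} {u} {v} {P} {w}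
  aα@(evα , _) aβ@(evβ , _) aγ@(evγ , _) dP closes =
  triangle-of-frames {α} {β} {γ} {cα} {csα} {cβ} {csβ} {cγ} {csγ} {P} {w} {Pa} {wa} {Pb} {wb}
    aα aβ aγ dP dPa dPb (walk-cf P w cα csα evα) (walk-cf Pa wa cβ csβ evβ) eP
  where
  Fa Fb : Pt × Pt
  Fa = shear u (walk (P , w) (cα ∷ csα))
  Fb = shear v (walk Fa (cβ ∷ csβ))
  Pa wa Pb wb : Pt
  Pa = proj₁ Fa
  wa = proj₂ Fa
  Pb = proj₁ Fb
  wb = proj₂ Fb
  dPa : det Pa wa ≡ 1ℤ
  dPa = trans (shear-det u (walk (P , w) (cα ∷ csα))) (trans (walk-det (P , w) (cα ∷ csα)) dP)
  dPb : det Pb wb ≡ 1ℤ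
  dPb = trans (shear-det v (walk Fa (cβ ∷ csβ))) (trans (walk-det Fa (cβ ∷ csβ)) dPa)
  splits : walk (P , w) ((cα ∷ csα) ++ u ∷ (cβ ∷ csβ) ++ v ∷ (cγ ∷ csγ)) ≡ walk Fb (cγ ∷ csγ)
  splits = trans (walk-++ (P , w) cα csα u _ evα) (walk-++ Fa cβ csβ v _ evβ)
  eP : neg P ≡ (cfDen cγ csγ • Pb) ⊕ (cfNum cγ csγ • wb)
  eP = trans (sym closes) (trans (cong proj₁ splits) (walk-cf Pb wb cγ csγ evγ))

adjugate : LAff → LAff
adjugate (laff a b c d _ _) = laff d (- b) (- c) a 0ℤ 0ℤ

apply-⊖ : ∀ f X Y → apply f X ⊖ apply f Y ≡ linear f (X ⊖ Y)
apply-⊖ (laff a b c d e g) (x₁ , x₂) (y₁ , y₂) =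
  cong₂ _,_ (eq a b e x₁ x₂ y₁ y₂) (eq c d g x₁ x₂ y₁ y₂)
  where
  eq : ∀ a b e x₁ x₂ y₁ y₂ →
    a * x₁ + b * x₂ + e - (a * y₁ + b * y₂ + e) ≡ a * (x₁ - y₁) + b * (x₂ - y₂)
  eq = solve-∀

linear-neg : ∀ f X → linear f (neg X) ≡ neg (linear f X)
linear-neg (laff a b c d _ _) (x , y) = cong₂ _,_ (eq a b x y) (eq c d x y)
  where
  eq : ∀ a b x y → a * - x + b * - y ≡ - (a * x + b * y)
  eq = solve-∀

linear-adjugate : ∀ f X → linear (adjugate f) (linear f X) ≡ detM f • X
linear-adjugate (laff a b c d _ _) (x , y) = cong₂ _,_ (eq₁ a b c d x y) (eq₂ a b c d x y)
  where
  eq₁ : ∀ a b c d x y → d * (a * x + b * y) + - b * (c * x + d * y) ≡ (a * d - b * c) * x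
  eq₁ = solve-∀
  eq₂ : ∀ a b c d x y → - c * (a * x + b * y) + a * (c * x + d * y) ≡ (a * d - b * c) * y
  eq₂ = solve-∀

linear-injective : ∀ f {X Y} → IsProper f → linear f X ≡ linear f Y → X ≡ Y
linear-injective f {X} {Y} proper eq = begin
  X                                  ≡⟨ sym (•-identityˡ X) ⟩
  1ℤ • X                             ≡⟨ cong (_• X) (sym proper) ⟩
  detM f • X                         ≡⟨ sym (linear-adjugate f X) ⟩
  linear (adjugate f) (linear f X)   ≡⟨ cong (linear (adjugate f)) eq ⟩
  linear (adjugate f) (linear f Y)   ≡⟨ linear-adjugate f Y ⟩
  detM f • Y                         ≡⟨ cong (_• Y) proper ⟩
  1ℤ • Y                             ≡⟨ •-identityˡ Y ⟩
  Y                                  ∎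

L₁-last : ∀ {L} → IsL 1 L → last L ≡ just (- 1ℤ , 0ℤ)
L₁-last (_ , ud , (_ , refl) , sls) = walk-last {u = 0ℤ , 1ℤ} {k = 1} sls ud first-edge
  where
  first-edge : SegData (1ℤ , 0ℤ) (1ℤ , 1ℤ) (0ℤ , 1ℤ) 1
  first-edge = refl , s≤s z≤n , refl

properCong-L₁-opposite : ∀ {L V A l W} → IsL 1 L → ProperCong V (A ∷ l) O L →
  last (A ∷ l) ≡ just (V ⊕ W) → W ≡ neg (A ⊖ V)
properCong-L₁-opposite {L} {V} {A} {l} {W}
  isL@(_ , _ , (_ , refl) , _) (f , proper , fV , heads , lasts , _) ends =
  linear-injective f {W} {neg (A ⊖ V)} proper (begin
    linear f W                     ≡⟨ cong (linear f) (sym (⊕-⊖-cancelˡ V W)) ⟩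
    linear f ((V ⊕ W) ⊖ V)         ≡⟨ sym (apply-⊖ f (V ⊕ W) V) ⟩
    apply f (V ⊕ W) ⊖ apply f V    ≡⟨ cong₂ _⊖_ fZ fV ⟩
    (- 1ℤ , 0ℤ) ⊖ O                ≡⟨⟩
    neg ((1ℤ , 0ℤ) ⊖ O)            ≡⟨ cong₂ (λ X Y → neg (X ⊖ Y)) (sym fA) (sym fV) ⟩
    neg (apply f A ⊖ apply f V)    ≡⟨ cong neg (apply-⊖ f A V) ⟩
    neg (linear f (A ⊖ V))         ≡⟨ sym (linear-neg f (A ⊖ V)) ⟩
    linear f (neg (A ⊖ V))         ∎)
  where
  fA : apply f A ≡ (1ℤ , 0ℤ)
  fA = just-injective heads
  fZ : apply f (V ⊕ W) ≡ (- 1ℤ , 0ℤ)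
  fZ = just-injective (begin
    just (apply f (V ⊕ W))               ≡⟨ cong (Maybe.map (apply f)) (sym ends) ⟩
    Maybe.map (apply f) (last (A ∷ l))   ≡⟨ sym (last-map (apply f) (A ∷ l)) ⟩
    last (map (apply f) (A ∷ l))         ≡⟨ lasts ⟩
    last L                               ≡⟨ L₁-last isL ⟩
    just (- 1ℤ , 0ℤ)                     ∎)

lemma4p5 : (α β γ : Angle) (u v : ℤ) →
    SumEq (α ∷ β ∷ γ ∷ []) (u ∷ v ∷ []) 1 →
    Σ Pt λ A → Σ Pt λ B → Σ Pt λ C →
      Σ (¬ Collinear A B C) λ nABC →
      Σ (¬ Collinear C A B) λ nCAB →
      Σ (¬ Collinear B C A) λ nBCA →
        LatticeCongruent (∠ C A B nCAB) α
        × LatticeCongruent (∠ A B C nABC) β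
        × LatticeCongruent (∠ B C A nBCA) γ
lemma4p5 α β γ u v
  (V , A ∷ B ∷ rest , s , cons {s = sα} aα (cons {s = sβ} aβ (single {s = sγ} aγ)) ,
   _ , ud , sls , L , isL , toL₁) =
  let (w , dPw , ends) = walk-traces {V} {A} {B} {rest} {s} sls ud
  in triangle-of-walk {α} {β} {γ} {sα} {sβ} {sγ} {u} {v} {A ⊖ V} {w} aα aβ aγ dPw
       (properCong-L₁-opposite {L} {V} {A} {B ∷ rest} isL toL₁ ends)
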